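{- Let $l\ge 1$ and $m\ge 1$ be integers, and let $0\le n\le lm$ be an integer. Let $i$, with $1\le i\le m$, be the smallest index such that $n\le il$. Then \[ P[X_{l,m}=n]=\frac{1}{(l+1)^m-1}\cdot\frac{l}{l+1}\sum_{j=i}^{m}\binom{j}{n}_{l+1}. \]
   Context: For integers $k\ge 0$ and $l\ge 0$, the polynomial coefficient $\binom{k}{n}_{l+1}$ is defined as the coefficient of $x^n$ in $(1+x+\dots+x^l)^k=\sum_{n=0}^{kl}\binom{k}{n}_{l+1}x^n$, and is taken to be $0$ for $n$ outside $\{0,\dots,kl\}$. $h_{l,m}(n)$ is the number of tuples $(\pi_1,\dots,\pi_k)$ with $1\le k\le m$ and integers $0\le\pi_j\le l$ such that $\pi_1+\dots+\pi_k=n$. $X_{l,m}$ is the random variable taking the value $n\in\{0,\dots,lm\}$ with probability $\frac{h_{l,m}(n)}{\sum_{i=0}^{lm}h_{l,m}(i)}$. -}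

module Defs where

open import Data.Nat using (ℕ; zero; suc; _+_; _*_; _∸_)
open import Data.Nat.Properties using (_≟_)
open import Data.Fin using (Fin; toℕ)
open import Data.Fin.Base using () renaming (zero to fzero; suc to fsuc)
open import Data.List using (List; []; _∷_; map; concatMap; upTo; replicate; filter; length; allFin)
open import Data.Nat.ListAction using (sum)
open import Data.Vec using (Vec; []; _∷_)
open import Data.Integer using (+_)
open import Data.Rational using (ℚ; _/_; 0ℚ)

-- Polynomials with natural coefficients as coefficient lists (lowest degree first).
Poly : Set
Poly = List ℕ

_⊕_ : Poly → Poly → Poly
[] ⊕ q = q
(a ∷ p) ⊕ [] = a ∷ p
(a ∷ p) ⊕ (b ∷ q) = (a + b) ∷ (p ⊕ q)

scale : ℕ → Poly → Poly
scale c = map (c *_)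

_⊗_ : Poly → Poly → Poly
[] ⊗ q = []
(a ∷ p) ⊗ q = scale a q ⊕ (0 ∷ (p ⊗ q))

_^ₚ_ : Poly → ℕ → Poly
p ^ₚ zero = 1 ∷ []
p ^ₚ suc k = p ⊗ (p ^ₚ k)

coeff : Poly → ℕ → ℕ
coeff [] n = 0
coeff (a ∷ p) zero = a
coeff (a ∷ p) (suc n) = coeff p n

geomPoly : ℕ → Poly
geomPoly l = replicate (suc l) 1

-- polynomial coefficient  binom(k, n)_{l+1}  = [x^n] (1 + x + ... + x^l)^k
polyCoeff : (l k n : ℕ) → ℕ
polyCoeff l k n = coeff (geomPoly l ^ₚ k) n

allTuples : (l k : ℕ) → List (Vec (Fin (suc l)) k)
allTuples l zero = [] ∷ []
allTuples l (suc k) = concatMap (λ x → map (x ∷_) (allTuples l k)) (allFin (suc l))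

tupleSum : ∀ {l k} → Vec (Fin (suc l)) k → ℕ
tupleSum [] = 0
tupleSum (x ∷ v) = toℕ x + tupleSum v

countTuples : (l k n : ℕ) → ℕ
countTuples l k n = length (filter (λ v → tupleSum v ≟ n) (allTuples l k))

-- Σ_{j=a}^{b} f j  (empty if b < a)
sumFromTo : ℕ → ℕ → (ℕ → ℕ) → ℕ
sumFromTo a b f = sum (map (λ t → f (a + t)) (upTo (suc b ∸ a)))

h : (l m n : ℕ) → ℕ
h l m n = sumFromTo 1 m (λ k → countTuples l k n)

-- rational a/b, with the (irrelevant here) convention a/0 = 0
_//_ : ℕ → ℕ → ℚ
a // zero = 0ℚ
a // suc b = (+ a) / suc b

probX : (l m n : ℕ) → ℚ
probX l m n = h l m n // sumFromTo 0 (l * m) (h l m)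

-- Counting tuples in {0,…,l}^k by the value of their sum gives exactly the coefficients of
-- (1 + x + ⋯ + x^l)^k, and there are (l+1)^k such tuples. Hence h_{l,m}(n) = Σ_{k=1}^m binom(k,n)_{l+1},
-- where the terms with k < i vanish because k l < n, and the normalising constant is the geometric
-- sum Σ_{k=1}^m (l+1)^k = (l+1)((l+1)^m − 1)/l.
module Submission where

open import Defs
open import Data.Nat using (ℕ; zero; suc; _+_; _*_; _∸_; _^_; _≤_; _<_; _≡ᵇ_; z≤n; s≤s; NonZero; >-nonZero)
open import Data.Nat.Properties
open import Data.Nat.ListAction using (sum)
open import Data.Nat.Tactic.RingSolver using (solve-∀)
open import Data.Bool using (true; false; if_then_else_; T)
open import Data.Unit using (tt)
open import Data.Fin as Fin using (Fin; toℕ)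
open import Data.Fin.Properties using (toℕ≤pred[n])
open import Data.List using (List; []; _∷_; _++_; map; concatMap; applyUpTo; filter; length; tabulate; replicate; allFin)
open import Data.List.Properties using (length-++; length-map; map-tabulate)
open import Data.Vec using (Vec; []; _∷_)
open import Data.Integer using () renaming (+_ to ⁺_; _*_ to _*ℤ_)
import Data.Integer.Properties as ℤ
open import Data.Rational using (fromℚᵘ) renaming (_*_ to _*ℚ_)
import Data.Rational.Properties as ℚ
open import Data.Rational.Unnormalised using (ℚᵘ; mkℚᵘ; *≡*) renaming (_*_ to _*ᵘ_)
import Data.Rational.Unnormalised.Properties as ℚᵘ
open import Relation.Binary.PropositionalEquality
open import Relation.Nullary using (¬_; contradiction)
open import Algebra.Properties.CommutativeSemigroup +-commutativeSemigroup using (interchange)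

Σ< : ℕ → (ℕ → ℕ) → ℕ
Σ< zero F = 0
Σ< (suc k) F = F 0 + Σ< k (λ t → F (suc t))

Σ<-cong : ∀ k {F G} → (∀ t → t < k → F t ≡ G t) → Σ< k F ≡ Σ< k G
Σ<-cong zero e = refl
Σ<-cong (suc k) e = cong₂ _+_ (e 0 (s≤s z≤n)) (Σ<-cong k (λ t t<k → e (suc t) (s≤s t<k)))

Σ<-zero : ∀ k {F} → (∀ t → t < k → F t ≡ 0) → Σ< k F ≡ 0
Σ<-zero zero e = refl
Σ<-zero (suc k) e = cong₂ _+_ (e 0 (s≤s z≤n)) (Σ<-zero k (λ t t<k → e (suc t) (s≤s t<k)))

Σ<-+ : ∀ k F G → Σ< k (λ t → F t + G t) ≡ Σ< k F + Σ< k G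
Σ<-+ zero F G = refl
Σ<-+ (suc k) F G = trans (cong (F 0 + G 0 +_) (Σ<-+ k _ _)) (interchange (F 0) (G 0) _ _)

Σ<-swap : ∀ a b (F : ℕ → ℕ → ℕ) → Σ< a (λ x → Σ< b (F x)) ≡ Σ< b (λ y → Σ< a (λ x → F x y))
Σ<-swap zero b F = sym (Σ<-zero b (λ _ _ → refl))
Σ<-swap (suc a) b F =
  trans (cong (Σ< b (F 0) +_) (Σ<-swap a b (λ x → F (suc x)))) (sym (Σ<-+ b (F 0) _))

Σ<-split : ∀ a b F → Σ< (a + b) F ≡ Σ< a F + Σ< b (λ t → F (a + t))
Σ<-split zero b F = refl
Σ<-split (suc a) b F = trans (cong (F 0 +_) (Σ<-split a b (λ t → F (suc t)))) (sym (+-assoc (F 0) _ _))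

Σ<-const : ∀ k c → Σ< k (λ _ → c) ≡ k * c
Σ<-const zero c = refl
Σ<-const (suc k) c = cong (c +_) (Σ<-const k c)

*-Σ< : ∀ c k F → c * Σ< k F ≡ Σ< k (λ t → c * F t)
*-Σ< c zero F = *-zeroʳ c
*-Σ< c (suc k) F = trans (*-distribˡ-+ c (F 0) _) (cong (c * F 0 +_) (*-Σ< c k (λ t → F (suc t))))

sum-map-applyUpTo : ∀ k (F g : ℕ → ℕ) → sum (map F (applyUpTo g k)) ≡ Σ< k (λ t → F (g t))
sum-map-applyUpTo zero F g = refl
sum-map-applyUpTo (suc k) F g = cong (F (g 0) +_) (sum-map-applyUpTo k F (λ t → g (suc t)))

sumFromTo≡Σ< : ∀ a b f → sumFromTo a b f ≡ Σ< (suc b ∸ a) (λ t → f (a + t))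
sumFromTo≡Σ< a b f = sum-map-applyUpTo (suc b ∸ a) (λ t → f (a + t)) (λ t → t)

sum-tabulate : ∀ n (f : Fin n → ℕ) (F : ℕ → ℕ) → (∀ i → f i ≡ F (toℕ i)) → sum (tabulate f) ≡ Σ< n F
sum-tabulate zero f F e = refl
sum-tabulate (suc n) f F e =
  cong₂ _+_ (e Fin.zero) (sum-tabulate n (λ i → f (Fin.suc i)) (λ t → F (suc t)) (λ i → e (Fin.suc i)))

sum-map-allFin : ∀ n (f : Fin n → ℕ) (F : ℕ → ℕ) → (∀ i → f i ≡ F (toℕ i)) → sum (map f (allFin n)) ≡ Σ< n F
sum-map-allFin n f F e = trans (cong sum (map-tabulate (λ i → i) f)) (sum-tabulate n f F e)

-- shift y g is the coefficient sequence of x^y times the series with coefficients g.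
shift : ℕ → (ℕ → ℕ) → ℕ → ℕ
shift zero g n = g n
shift (suc y) g zero = 0
shift (suc y) g (suc n) = shift y g n

shift-cong : ∀ {g g'} → (∀ n → g n ≡ g' n) → ∀ y n → shift y g n ≡ shift y g' n
shift-cong e zero n = e n
shift-cong e (suc y) zero = refl
shift-cong e (suc y) (suc n) = shift-cong e y n

shift-zero : ∀ y n → shift y (λ _ → 0) n ≡ 0
shift-zero zero n = refl
shift-zero (suc y) zero = refl
shift-zero (suc y) (suc n) = shift-zero y n

shift-+ : ∀ g g' y n → shift y (λ k → g k + g' k) n ≡ shift y g n + shift y g' n
shift-+ g g' zero n = refl
shift-+ g g' (suc y) zero = refl
shift-+ g g' (suc y) (suc n) = shift-+ g g' y n

coeff-⊕ : ∀ p q n → coeff (p ⊕ q) n ≡ coeff p n + coeff q n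
coeff-⊕ [] q n = refl
coeff-⊕ (a ∷ p) [] zero = sym (+-identityʳ a)
coeff-⊕ (a ∷ p) [] (suc n) = sym (+-identityʳ _)
coeff-⊕ (a ∷ p) (b ∷ q) zero = refl
coeff-⊕ (a ∷ p) (b ∷ q) (suc n) = coeff-⊕ p q n

coeff-scale : ∀ c q n → coeff (scale c q) n ≡ c * coeff q n
coeff-scale c [] n = sym (*-zeroʳ c)
coeff-scale c (a ∷ q) zero = refl
coeff-scale c (a ∷ q) (suc n) = coeff-scale c q n

coeff-geomPoly-⊗ : ∀ l q n → coeff (geomPoly l ⊗ q) n ≡ Σ< (suc l) (λ y → shift y (coeff q) n)
coeff-geomPoly-⊗ l q n =
  trans (coeff-⊕ (scale 1 q) _ n) (cong₂ _+_ (trans (coeff-scale 1 q n) (*-identityˡ _)) (higher l n))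
  where
  higher : ∀ l n → coeff (0 ∷ (replicate l 1 ⊗ q)) n ≡ Σ< l (λ y → shift (suc y) (coeff q) n)
  higher l zero = sym (Σ<-zero l (λ _ _ → refl))
  higher zero (suc n) = refl
  higher (suc l) (suc n) = coeff-geomPoly-⊗ l q n

-- Defined through _≡ᵇ_, on which _≟_ on ℕ computes, so that a filter step reduces to δ.
δ : ℕ → ℕ → ℕ
δ a n = if a ≡ᵇ n then 1 else 0

δ-refl : ∀ a → δ a a ≡ 1
δ-refl zero = refl
δ-refl (suc a) = δ-refl a

δ-≢ : ∀ {a n} → ¬ a ≡ n → δ a n ≡ 0
δ-≢ {a} {n} a≢n with a ≡ᵇ n in eq
... | true = contradiction (≡ᵇ⇒≡ a n (subst T (sym eq) tt)) a≢n
... | false = refl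

δ-shift : ∀ a y n → δ (y + a) n ≡ shift y (δ a) n
δ-shift a zero n = refl
δ-shift a (suc y) zero = refl
δ-shift a (suc y) (suc n) = δ-shift a y n

Σ<-δ : ∀ {a N} → a ≤ N → Σ< (suc N) (δ a) ≡ 1
Σ<-δ {zero} {N} _ = cong suc (Σ<-zero N (λ _ _ → refl))
Σ<-δ {suc a} {suc N} (s≤s a≤N) = Σ<-δ a≤N

count : {A : Set} → (A → ℕ) → List A → ℕ → ℕ
count s L n = length (filter (λ v → s v ≟ n) L)

module _ {A : Set} (s : A → ℕ) where

  count-∷ : ∀ a L n → count s (a ∷ L) n ≡ δ (s a) n + count s L n
  count-∷ a L n with s a ≡ᵇ n
  ... | true = refl
  ... | false = refl

  count-++ : ∀ K L n → count s (K ++ L) n ≡ count s K n + count s L n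
  count-++ [] L n = refl
  count-++ (a ∷ K) L n = begin
    count s (a ∷ K ++ L) n                  ≡⟨ count-∷ a (K ++ L) n ⟩
    δ (s a) n + count s (K ++ L) n          ≡⟨ cong (δ (s a) n +_) (count-++ K L n) ⟩
    δ (s a) n + (count s K n + count s L n) ≡⟨ +-assoc (δ (s a) n) _ _ ⟨
    δ (s a) n + count s K n + count s L n   ≡⟨ cong (_+ count s L n) (count-∷ a K n) ⟨
    count s (a ∷ K) n + count s L n         ∎
    where open ≡-Reasoning

  count-concatMap : ∀ {B : Set} (f : B → List A) xs n →
    count s (concatMap f xs) n ≡ sum (map (λ x → count s (f x) n) xs)
  count-concatMap f [] n = refl
  count-concatMap f (x ∷ xs) n =
    trans (count-++ (f x) (concatMap f xs) n) (cong (count s (f x) n +_) (count-concatMap f xs n))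

  count-≡0 : ∀ L n → (∀ a → s a < n) → count s L n ≡ 0
  count-≡0 [] n _ = refl
  count-≡0 (a ∷ L) n below = trans (count-∷ a L n)
    (cong₂ _+_ (δ-≢ (λ sa≡n → <-irrefl sa≡n (below a))) (count-≡0 L n below))

  Σ<-count : ∀ L N → (∀ a → s a ≤ N) → Σ< (suc N) (count s L) ≡ length L
  Σ<-count [] N _ = Σ<-zero (suc N) (λ _ _ → refl)
  Σ<-count (a ∷ L) N bounded = begin
    Σ< (suc N) (count s (a ∷ L))                       ≡⟨ Σ<-cong (suc N) (λ t _ → count-∷ a L t) ⟩
    Σ< (suc N) (λ t → δ (s a) t + count s L t)         ≡⟨ Σ<-+ (suc N) (δ (s a)) (count s L) ⟩
    Σ< (suc N) (δ (s a)) + Σ< (suc N) (count s L)      ≡⟨ cong₂ _+_ (Σ<-δ (bounded a)) (Σ<-count L N bounded) ⟩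
    suc (length L)                                     ∎
    where open ≡-Reasoning

length-concatMap : ∀ {A B : Set} (f : B → List A) xs → length (concatMap f xs) ≡ sum (map (λ x → length (f x)) xs)
length-concatMap f [] = refl
length-concatMap f (x ∷ xs) = trans (length-++ (f x)) (cong (length (f x) +_) (length-concatMap f xs))

count-map-∷ : ∀ {l k} (x : Fin (suc l)) (L : List (Vec (Fin (suc l)) k)) n →
  count tupleSum (map (x ∷_) L) n ≡ shift (toℕ x) (count tupleSum L) n
count-map-∷ x [] n = sym (shift-zero (toℕ x) n)
count-map-∷ x (v ∷ L) n = begin
  count tupleSum (map (x ∷_) (v ∷ L)) n
    ≡⟨ count-∷ tupleSum (x ∷ v) (map (x ∷_) L) n ⟩
  δ (toℕ x + tupleSum v) n + count tupleSum (map (x ∷_) L) n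
    ≡⟨ cong₂ _+_ (δ-shift (tupleSum v) (toℕ x) n) (count-map-∷ x L n) ⟩
  shift (toℕ x) (δ (tupleSum v)) n + shift (toℕ x) (count tupleSum L) n
    ≡⟨ shift-+ (δ (tupleSum v)) (count tupleSum L) (toℕ x) n ⟨
  shift (toℕ x) (λ k → δ (tupleSum v) k + count tupleSum L k) n
    ≡⟨ shift-cong (λ k → count-∷ tupleSum v L k) (toℕ x) n ⟨
  shift (toℕ x) (count tupleSum (v ∷ L)) n ∎
  where open ≡-Reasoning

countTuples≡polyCoeff : ∀ l k n → countTuples l k n ≡ polyCoeff l k n
countTuples≡polyCoeff l zero zero = refl
countTuples≡polyCoeff l zero (suc n) = refl
countTuples≡polyCoeff l (suc k) n = begin
  count tupleSum (concatMap (λ x → map (x ∷_) (allTuples l k)) (allFin (suc l))) n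
    ≡⟨ count-concatMap tupleSum (λ x → map (x ∷_) (allTuples l k)) (allFin (suc l)) n ⟩
  sum (map (λ x → count tupleSum (map (x ∷_) (allTuples l k)) n) (allFin (suc l)))
    ≡⟨ sum-map-allFin (suc l) _ (λ y → shift y (polyCoeff l k) n) (λ x →
         trans (count-map-∷ x (allTuples l k) n) (shift-cong (countTuples≡polyCoeff l k) (toℕ x) n)) ⟩
  Σ< (suc l) (λ y → shift y (polyCoeff l k) n)
    ≡⟨ coeff-geomPoly-⊗ l (geomPoly l ^ₚ k) n ⟨
  polyCoeff l (suc k) n ∎
  where open ≡-Reasoning

length-allTuples : ∀ l k → length (allTuples l k) ≡ suc l ^ k
length-allTuples l zero = refl
length-allTuples l (suc k) = begin
  length (concatMap (λ x → map (x ∷_) (allTuples l k)) (allFin (suc l)))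
    ≡⟨ length-concatMap (λ x → map (x ∷_) (allTuples l k)) (allFin (suc l)) ⟩
  sum (map (λ x → length (map (x ∷_) (allTuples l k))) (allFin (suc l)))
    ≡⟨ sum-map-allFin (suc l) _ (λ _ → suc l ^ k)
         (λ x → trans (length-map (x ∷_) (allTuples l k)) (length-allTuples l k)) ⟩
  Σ< (suc l) (λ _ → suc l ^ k)
    ≡⟨ Σ<-const (suc l) _ ⟩
  suc l ^ suc k ∎
  where open ≡-Reasoning

tupleSum≤ : ∀ {l k} (v : Vec (Fin (suc l)) k) → tupleSum v ≤ k * l
tupleSum≤ [] = z≤n
tupleSum≤ (x ∷ v) = +-mono-≤ (toℕ≤pred[n] x) (tupleSum≤ v)

countTuples-≡0 : ∀ l k n → k * l < n → countTuples l k n ≡ 0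
countTuples-≡0 l k n kl<n = count-≡0 tupleSum (allTuples l k) n (λ v → ≤-<-trans (tupleSum≤ v) kl<n)

Σ<-countTuples : ∀ l k N → k * l ≤ N → Σ< (suc N) (countTuples l k) ≡ suc l ^ k
Σ<-countTuples l k N kl≤N =
  trans (Σ<-count tupleSum (allTuples l k) N (λ v → ≤-trans (tupleSum≤ v) kl≤N)) (length-allTuples l k)

h≡sumFromTo-polyCoeff : ∀ l m n i → i ≤ m → (∀ j → j < i → suc j * l < n) →
  h l m n ≡ sumFromTo (suc i) m (λ j → polyCoeff l j n)
h≡sumFromTo-polyCoeff l m n i i≤m below = begin
  h l m n                                         ≡⟨ sumFromTo≡Σ< 1 m (λ k → countTuples l k n) ⟩
  Σ< m F                                          ≡⟨ cong (λ k → Σ< k F) (m+[n∸m]≡n i≤m) ⟨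
  Σ< (i + (m ∸ i)) F                              ≡⟨ Σ<-split i (m ∸ i) F ⟩
  Σ< i F + Σ< (m ∸ i) (λ t → F (i + t))
    ≡⟨ cong₂ _+_ (Σ<-zero i (λ j j<i → countTuples-≡0 l (suc j) n (below j j<i)))
                 (Σ<-cong (m ∸ i) (λ t _ → countTuples≡polyCoeff l (suc i + t) n)) ⟩
  Σ< (m ∸ i) (λ t → polyCoeff l (suc i + t) n)    ≡⟨ sumFromTo≡Σ< (suc i) m (λ j → polyCoeff l j n) ⟨
  sumFromTo (suc i) m (λ j → polyCoeff l j n)     ∎
  where
  open ≡-Reasoning
  F : ℕ → ℕ
  F t = countTuples l (suc t) n

total-h : ∀ l m → sumFromTo 0 (l * m) (h l m) ≡ Σ< m (λ t → suc l ^ suc t)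
total-h l m = begin
  sumFromTo 0 (l * m) (h l m)
    ≡⟨ sumFromTo≡Σ< 0 (l * m) (h l m) ⟩
  Σ< (suc (l * m)) (h l m)
    ≡⟨ Σ<-cong (suc (l * m)) (λ n _ → sumFromTo≡Σ< 1 m (λ k → countTuples l k n)) ⟩
  Σ< (suc (l * m)) (λ n → Σ< m (λ t → countTuples l (suc t) n))
    ≡⟨ Σ<-swap m (suc (l * m)) (λ t → countTuples l (suc t)) ⟨
  Σ< m (λ t → Σ< (suc (l * m)) (countTuples l (suc t)))
    ≡⟨ Σ<-cong m (λ t t<m → Σ<-countTuples l (suc t) (l * m) (subst (_≤ l * m) (*-comm l (suc t)) (*-monoʳ-≤ l t<m))) ⟩
  Σ< m (λ t → suc l ^ suc t) ∎
  where open ≡-Reasoning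

geometric-sum-+ : ∀ l m → l * Σ< m (λ t → suc l ^ suc t) + suc l ≡ suc l ^ suc m
geometric-sum-+ l zero = trans (cong (_+ suc l) (*-zeroʳ l)) (sym (*-identityʳ (suc l)))
geometric-sum-+ l (suc m) = begin
  l * (suc l ^ 1 + Σ< m (λ t → suc l * suc l ^ suc t)) + suc l
    ≡⟨ cong (λ z → l * (suc l ^ 1 + z) + suc l) (*-Σ< (suc l) m (λ t → suc l ^ suc t)) ⟨
  l * (suc l * 1 + suc l * G) + suc l
    ≡⟨ regroup l G ⟩
  suc l * (l * G + suc l)
    ≡⟨ cong (suc l *_) (geometric-sum-+ l m) ⟩
  suc l ^ suc (suc m) ∎
  where
  open ≡-Reasoning
  G : ℕ
  G = Σ< m (λ t → suc l ^ suc t)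
  regroup : ∀ l G → l * (suc l * 1 + suc l * G) + suc l ≡ suc l * (l * G + suc l)
  regroup = solve-∀

geometric-sum : ∀ l m → Σ< m (λ t → suc l ^ suc t) * l ≡ suc l * (suc l ^ m ∸ 1)
geometric-sum l m = begin
  G * l                             ≡⟨ *-comm G l ⟩
  l * G                             ≡⟨ m+n∸n≡m (l * G) (suc l) ⟨
  l * G + suc l ∸ suc l             ≡⟨ cong (_∸ suc l) (geometric-sum-+ l m) ⟩
  suc l ^ suc m ∸ suc l             ≡⟨ cong (suc l ^ suc m ∸_) (*-identityʳ (suc l)) ⟨
  suc l * suc l ^ m ∸ suc l * 1     ≡⟨ *-distribˡ-∸ (suc l) (suc l ^ m) 1 ⟨
  suc l * (suc l ^ m ∸ 1)           ∎
  where
  open ≡-Reasoning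
  G : ℕ
  G = Σ< m (λ t → suc l ^ suc t)

fromℚᵘ-homo-* : ∀ p q → fromℚᵘ p *ℚ fromℚᵘ q ≡ fromℚᵘ (p *ᵘ q)
fromℚᵘ-homo-* p q = ℚ.toℚᵘ-injective
  (ℚᵘ.≃-trans (ℚ.toℚᵘ-homo-* (fromℚᵘ p) (fromℚᵘ q))
  (ℚᵘ.≃-trans (ℚᵘ.*-cong (ℚ.toℚᵘ-fromℚᵘ p) (ℚ.toℚᵘ-fromℚᵘ q))
  (ℚᵘ.≃-sym (ℚ.toℚᵘ-fromℚᵘ (p *ᵘ q)))))

-- The degenerate cases T = 0 or D = 0 hold too, because _//_ sends division by 0 to 0.
//-rescale : ∀ S T D a b .{{_ : NonZero a}} → T * a ≡ b * D →
  S // T ≡ ((1 // D) *ℚ (a // b)) *ℚ (S // 1)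
//-rescale S zero zero a b e = sym (trans (cong (_*ℚ (S // 1)) (ℚ.*-zeroˡ (a // b))) (ℚ.*-zeroˡ (S // 1)))
//-rescale S zero (suc d) a zero e = sym (trans (cong (_*ℚ (S // 1)) (ℚ.*-zeroʳ (1 // suc d))) (ℚ.*-zeroˡ (S // 1)))
//-rescale S zero (suc d) a (suc b) ()
//-rescale S (suc t) zero (suc a) b e = contradiction (trans e (*-zeroʳ b)) λ ()
//-rescale S (suc t) (suc d) (suc a) zero ()
//-rescale S (suc t) (suc d) (suc a) (suc b) e = begin
  fromℚᵘ (mkℚᵘ (⁺ S) t)            ≡⟨ ℚ.fromℚᵘ-cong {mkℚᵘ (⁺ S) t} {(D⁻¹ *ᵘ a/b) *ᵘ S/1} (*≡* cross-multiplied) ⟩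
  fromℚᵘ ((D⁻¹ *ᵘ a/b) *ᵘ S/1)      ≡⟨ fromℚᵘ-homo-* (D⁻¹ *ᵘ a/b) S/1 ⟨
  fromℚᵘ (D⁻¹ *ᵘ a/b) *ℚ (S // 1)   ≡⟨ cong (_*ℚ (S // 1)) (fromℚᵘ-homo-* D⁻¹ a/b) ⟨
  ((1 // suc d) *ℚ (suc a // suc b)) *ℚ (S // 1) ∎
  where
  open ≡-Reasoning
  D⁻¹ a/b S/1 : ℚᵘ
  D⁻¹ = mkℚᵘ (⁺ 1) d
  a/b = mkℚᵘ (⁺ suc a) b
  S/1 = mkℚᵘ (⁺ S) 0
  reassociate : ∀ S T a → S * (T * a) ≡ 1 * a * S * T
  reassociate = solve-∀
  cross-multipliedℕ : S * (suc d * suc b * 1) ≡ 1 * suc a * S * suc t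
  cross-multipliedℕ = trans
    (cong (S *_) (trans (*-identityʳ _) (trans (*-comm (suc d) (suc b)) (sym e))))
    (reassociate S (suc t) (suc a))
  cross-multiplied : ⁺ S *ℤ ⁺ (suc d * suc b * 1) ≡ ((⁺ 1 *ℤ ⁺ suc a) *ℤ ⁺ S) *ℤ ⁺ suc t
  cross-multiplied = begin
    ⁺ S *ℤ ⁺ (suc d * suc b * 1)             ≡⟨ ℤ.pos-* S _ ⟨
    ⁺ (S * (suc d * suc b * 1))              ≡⟨ cong ⁺_ cross-multipliedℕ ⟩
    ⁺ (1 * suc a * S * suc t)                ≡⟨ ℤ.pos-* (1 * suc a * S) (suc t) ⟩
    ⁺ (1 * suc a * S) *ℤ ⁺ suc t             ≡⟨ cong (_*ℤ ⁺ suc t) (ℤ.pos-* (1 * suc a) S) ⟩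
    (⁺ (1 * suc a) *ℤ ⁺ S) *ℤ ⁺ suc t        ≡⟨ cong (λ z → (z *ℤ ⁺ S) *ℤ ⁺ suc t) (ℤ.pos-* 1 (suc a)) ⟩
    ((⁺ 1 *ℤ ⁺ suc a) *ℤ ⁺ S) *ℤ ⁺ suc t     ∎

lemma1 : (l m n i : ℕ) → 1 ≤ l → 1 ≤ m → n ≤ l * m →
         1 ≤ i → i ≤ m → n ≤ i * l →
         (∀ j → 1 ≤ j → j < i → ¬ (n ≤ j * l)) →
         probX l m n ≡
           ((1 // ((l + 1) ^ m ∸ 1)) *ℚ (l // (l + 1)))
             *ℚ (sumFromTo i m (λ j → polyCoeff l j n) // 1)
lemma1 l m n (suc i) 1≤l _ _ _ i<m _ minimal rewrite +-comm l 1 = begin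
  h l m n // total                                               ≡⟨ cong (_// total) h≡S ⟩
  S // total                                                     ≡⟨ //-rescale S total _ l (suc l) {{>-nonZero 1≤l}} total*l ⟩
  ((1 // (suc l ^ m ∸ 1)) *ℚ (l // suc l)) *ℚ (S // 1)           ∎
  where
  open ≡-Reasoning
  total : ℕ
  total = sumFromTo 0 (l * m) (h l m)
  S : ℕ
  S = sumFromTo (suc i) m (λ j → polyCoeff l j n)
  h≡S : h l m n ≡ S
  h≡S = h≡sumFromTo-polyCoeff l m n i (<⇒≤ i<m)
    (λ j j<i → ≰⇒> (minimal (suc j) (s≤s z≤n) (s≤s j<i)))
  total*l : total * l ≡ suc l * (suc l ^ m ∸ 1)
  total*l = trans (cong (_* l) (total-h l m)) (geometric-sum l m)
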